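{- Let $b,m,c,q,n\in\mathbb{N}$ and let $d>0$ be real. Let $(G,T,r,(J_t)_{t\in V(T)})$ be a rooted tree-decomposition of an $n$-vertex graph $G$ that has near-weight at most $d$ and admits a $(b,m,d/2,c,q)$-decomposition at $r$. Then $G$ admits an almost-partition of treewidth at most $b$, width at most $d$, and loss at most $2(c+m)|V(G)|/d+q$.
   Context: Graphs are finite, may have parallel edges and loops; the empty set is a clique. A partition $\mathcal{P}$ of $G$: pairwise disjoint subsets (parts, empty allowed) of $V(G)$ with union $V(G)$; width = max part size; $G/\mathcal{P}$ = simple graph on $\mathcal{P}$, distinct $P_1,P_2$ adjacent iff $P_2\cap N_G(P_1)\ne\emptyset$; treewidth of $\mathcal{P}$ = treewidth of $G/\mathcal{P}$. An almost-partition $(X,\mathcal{P})$: $X\subseteq V(G)$, $\mathcal{P}$ a partition of $G-X$; width/treewidth those of $\mathcal{P}$; loss $|X|$. $(X,\mathcal{P})$ is $(b,m,\mathcal{K})$-concentrated ($\mathcal{K}\subseteq 2^{V(G)}$) if for each clique $Q$ of $(G-X)/\mathcal{P}$ there is $S_Q\subseteq V(G)$, $|S_Q|\le m$, such that for each $K\in\mathcal{K}$, $K\setminus S_Q$ meets at most $b$ parts of $Q$. A rooted tree-decomposition $(G,T,r,(J_t))$ is a tree-decomposition over a tree $T$ rooted at $r$; $p(t)$ is the parent of $t\neq r$. $K_r=\emptyset$, $K_t=J_t\cap J_{p(t)}$ ($t\ne r$), $J_t^-=J_t\setminus K_t$. The torso $G\langle J_t\rangle$ is $G[J_t]$ plus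 edges making $J_t\cap J_{t'}$ a clique for each neighbour $t'$ of $t$; $H_t=G\langle J_t\rangle-K_t$. A $(b,m,w,c,q)$-decomposition at $t$ (with $w>0$ real) is a triple $(X,\mathcal{P},\mathcal{K})$ with $\mathcal{K}\subseteq 2^{J_t^- }$ closed under subsets, $K_{t'}\setminus K_t\in\mathcal{K}$ for each child $t'$ of $t$, and $(X,\mathcal{P})$ a $(b,m,\mathcal{K})$-concentrated almost-partition of $H_t$ with treewidth $\le b$, width $\le w$, loss $\le c|J_t^-|/w+q$. For a subtree $T'$ of $T$, its weight is $|\bigcup_{t\in V(T')}J_t^-|$. The near-weight of the rooted tree-decomposition is the maximum weight of a subtree of $T-r$. -}

module Defs where

open import Data.Nat as ℕ using (ℕ; suc; _*_; _∸_)
open import Data.Fin using (Fin; _≟_)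
open import Data.Fin.Subset using (Subset; _∈_; _∉_; _⊆_; _∩_; _─_; ∣_∣; ⊥)
open import Data.Rational as ℚ using (ℚ; 0ℚ)
open import Data.Product using (Σ; ∃; _×_; _,_)
open import Data.Sum using (_⊎_)
open import Data.Integer using (+_)
open import Data.Empty renaming (⊥ to Empty)
open import Relation.Binary.PropositionalEquality using (_≡_; _≢_)
open import Relation.Nullary using (¬_; yes; no)

-- Positive real numbers, as two-sided Dedekind cuts of ℚ.
-- Lower = {p ∈ ℚ | p < d},  Upper = {p ∈ ℚ | d < p}.

record PosReal : Set₁ where
  field
    Lower Upper   : ℚ → Set
    lower-inhab   : ∃ λ p → Lower p
    upper-inhab   : ∃ λ p → Upper p
    lower-down    : ∀ p p' → p' ℚ.< p → Lower p → Lower p'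
    lower-open    : ∀ p → Lower p → ∃ λ p' → p ℚ.< p' × Lower p'
    upper-up      : ∀ p p' → p ℚ.< p' → Upper p → Upper p'
    upper-open    : ∀ p → Upper p → ∃ λ p' → p' ℚ.< p × Upper p'
    disjoint      : ∀ p → Lower p → Upper p → Empty
    located       : ∀ p p' → p ℚ.< p' → Lower p ⊎ Upper p'
    positive      : Lower 0ℚ
open PosReal public

_≤ʳ_ : ℕ → PosReal → Set
x ≤ʳ d = ∀ u → Upper d u → ((+ x) ℚ./ 1) ℚ.≤ u

_·_≤ʳ_ : ℕ → PosReal → ℕ → Set
a · d ≤ʳ y = ∀ e → Lower d e → e ℚ.* ((+ a) ℚ./ 1) ℚ.≤ ((+ y) ℚ./ 1)

-- "L ≤ Y / d + q", written multiplied out:  (L ∸ q) · d ≤ Y.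
-- (If L ≤ q both sides hold trivially; otherwise divide by d > 0.)
LossBound : ℕ → (Y : ℕ) → PosReal → (q : ℕ) → Set
LossBound L Y d q = (L ∸ q) · d ≤ʳ Y

-- Graphs.  Vertex set Fin n; parallel edges are irrelevant to every
-- notion below, so a graph is given by its (symmetric) adjacency relation
-- (loops allowed: E v v may hold).

Adj : ℕ → Set₁
Adj n = Fin n → Fin n → Set

record Graph (n : ℕ) : Set₁ where
  field
    E   : Adj n
    sym : ∀ u v → E u v → E v u
open Graph public

module _ {k : ℕ} (root : Fin k) (par : Fin k → Fin k) where
  data ReachesRoot : Fin k → Set where
    here  : ReachesRoot root
    step  : ∀ t → t ≢ root → ReachesRoot (par t) → ReachesRoot t

record RootedTree : Set where
  field
    size    : ℕ
    root    : Fin size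
    par     : Fin size → Fin size
    par-root : par root ≡ root
    reaches : ∀ t → ReachesRoot root par t
open RootedTree public

Node : RootedTree → Set
Node T = Fin (size T)

Child : (T : RootedTree) → Node T → Node T → Set
Child T t t' = (t' ≢ root T) × (par T t' ≡ t)

TEdge : (T : RootedTree) → Node T → Node T → Set
TEdge T t t' = Child T t t' ⊎ Child T t' t

data PathIn (T : RootedTree) (S : Node T → Set) : Node T → Node T → Set where
  stay : ∀ t → S t → PathIn T S t t
  move : ∀ t t' t'' → S t → TEdge T t t' → PathIn T S t' t'' → PathIn T S t t''

ConnectedIn : (T : RootedTree) → (Node T → Set) → Set
ConnectedIn T S = ∀ t t' → S t → S t' → PathIn T S t t'

record TreeDecomp {n : ℕ} (E : Adj n) : Set₁ where
  field
    tree   : RootedTree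
    bag    : Node tree → Subset n
    cover  : ∀ v → ∃ λ t → v ∈ bag t
    edge   : ∀ u v → E u v → ∃ λ t → (u ∈ bag t) × (v ∈ bag t)
    conn   : ∀ v → ConnectedIn tree (λ t → v ∈ bag t)
open TreeDecomp public

TreewidthAtMost : {n : ℕ} → Adj n → ℕ → Set₁
TreewidthAtMost E b = Σ (TreeDecomp E) λ D → ∀ t → ∣ bag D t ∣ ℕ.≤ suc b

record Partition {n : ℕ} (V : Subset n) : Set where
  field
    nparts   : ℕ
    part     : Fin nparts → Subset n
    inside   : ∀ i → part i ⊆ V
    covers   : ∀ v → v ∈ V → ∃ λ i → v ∈ part i
    disj     : ∀ i j → i ≢ j → ∀ v → v ∈ part i → v ∈ part j → Empty
open Partition public

QAdj : {n : ℕ} {V : Subset n} → Adj n → (P : Partition V) → Adj (nparts P)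
QAdj E P i j = (i ≢ j) × ∃ λ u → ∃ λ v → (u ∈ part P i) × (v ∈ part P j) × E u v

WidthAtMost : {n : ℕ} {V : Subset n} → Partition V → (ℕ → Set) → Set
WidthAtMost P le = ∀ i → le ∣ part P i ∣

record AlmostPartition {n : ℕ} (V : Subset n) : Set where
  field
    X     : Subset n
    X⊆V   : X ⊆ V
    parts : Partition (V ─ X)
open AlmostPartition public

QClique : {n : ℕ} {V : Subset n} → Adj n → (P : Partition V) → Subset (nparts P) → Set
QClique E P Q = ∀ i j → i ∈ Q → j ∈ Q → i ≢ j → QAdj E P i j

MeetsAtMost : {n : ℕ} {V : Subset n} (P : Partition V) → Subset n → ℕ → Subset (nparts P) → Set
MeetsAtMost P A b Q =
  ∃ λ B → B ⊆ Q × ∣ B ∣ ℕ.≤ b ×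
    (∀ i → i ∈ Q → (∃ λ v → v ∈ A × v ∈ part P i) → i ∈ B)

Concentrated : {n : ℕ} {V : Subset n} → Adj n → AlmostPartition V →
               (b m : ℕ) → (Subset n → Set) → Set
Concentrated E A b m 𝒦 =
  ∀ Q → QClique E (parts A) Q →
    ∃ λ S → ∣ S ∣ ℕ.≤ m × (∀ K → 𝒦 K → MeetsAtMost (parts A) (K ─ S) b Q)

module RTD {n : ℕ} (G : Graph n) (D : TreeDecomp (E G)) where
  T = tree D
  J = bag D

  K : Node T → Subset n
  K t with t ≟ root T
  ... | yes _ = ⊥
  ... | no  _ = J t ∩ J (par T t)

  J⁻ : Node T → Subset n
  J⁻ t = J t ─ K t

  -- adjacency of the torso G⟨J_t⟩ (restricted to J_t implicitly: all
  -- vertex sets used below are subsets of J_t)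
  TorsoAdj : Node T → Adj n
  TorsoAdj t u v =
    E G u v ⊎ ((u ≢ v) × ∃ λ t' → TEdge T t t' × u ∈ J t × u ∈ J t' × v ∈ J t × v ∈ J t')

  -- H_t = G⟨J_t⟩ − K_t has vertex set J⁻ t and adjacency TorsoAdj t.

  -- (b, m, w, c, q)-decomposition at t, with w = d / 2:
  -- loss ≤ c |J_t^-| / (d/2) + q = 2c |J_t^-| / d + q.
  record HalfDecompAt (b m : ℕ) (d : PosReal) (c q : ℕ) (t : Node T) : Set₁ where
    field
      𝒦         : Subset n → Set
      𝒦⊆        : ∀ K' → 𝒦 K' → K' ⊆ J⁻ t
      𝒦-down    : ∀ K' K'' → 𝒦 K' → K'' ⊆ K' → 𝒦 K''
      𝒦-child   : ∀ t' → Child T t t' → 𝒦 (K t' ─ K t)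
      ap        : AlmostPartition (J⁻ t)
      conc      : Concentrated (TorsoAdj t) ap b m 𝒦
      tw        : TreewidthAtMost (QAdj (TorsoAdj t) (parts ap)) b
      width     : WidthAtMost (parts ap) (λ s → (2 * s) ≤ʳ d)
      loss      : LossBound ∣ X ap ∣ (2 * c * ∣ J⁻ t ∣) d q

  -- weight of a node set S:  | ⋃_{t ∈ S} J_t^- |  ≤ d
  WeightAtMost : (Node T → Set) → PosReal → Set
  WeightAtMost S d = ∀ U → (∀ v → (v ∈ U → ∃ λ t → S t × v ∈ J⁻ t)
                                × ((∃ λ t → S t × v ∈ J⁻ t) → v ∈ U))
                       → ∣ U ∣ ≤ʳ d

  NearWeightAtMost : PosReal → Set₁
  NearWeightAtMost d = ∀ (S : Node T → Set) → (S (root T) → Empty) → ConnectedIn T S → WeightAtMost S d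

-- Keep the parts of the root almost-partition (X, 𝒫) of H_r and turn every branch of T (a child t
-- of r with its subtree) into one new part: by the near-weight bound it has at most d vertices, and
-- it is adjacent only to parts meeting K_t, which is a clique of the torso at r. If at most b parts
-- meet K_t, the new part becomes a leaf of the tree-decomposition of the quotient, attached to a bag
-- containing that clique. A larger clique fills a whole bag, the top bag of one of its parts y, and
-- the branches with this target y form a group. Either the group fits together with P_y into width
-- d and is merged into P_y, which is already adjacent to the whole clique, or it has at least d/2
-- vertices; then deleting the concentration set of the clique (at most m vertices) leaves each of
-- its branches adjacent to at most b parts. Charging those m deletions to the at least d/2 vertices
-- of the group costs at most 2mn/d in total.

{-# OPTIONS --safe #-}
module Submission where

open import Defs
open import Data.Nat using (ℕ; _*_; _+_)
open import Data.Fin.Subset using (⊤; ∣_∣)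
open import Data.Product using (Σ; _×_)

open import Data.Bool.Base using (Bool; true; false; not; if_then_else_)
import Data.Bool.Properties as Bool
open import Data.Empty using (⊥-elim) renaming (⊥ to Empty)
open import Data.Fin.Base using (Fin; zero; suc; splitAt; _↑ˡ_; _↑ʳ_)
open import Data.Fin.Properties using (_≟_; any?; splitAt-↑ˡ; splitAt-↑ʳ; splitAt⁻¹-↑ˡ; splitAt⁻¹-↑ʳ; ↑ˡ-injective)
open import Data.Fin.Subset using (Subset; _∈_; _∉_; _⊆_; _∪_; _∩_; _─_; ⁅_⁆; Nonempty) renaming (⊥ to ∅)
open import Data.Fin.Subset.Properties using (_∈?_; ∈⊤; ∉⊥; ⊥⊆; ∣⊥∣≡0; ∣p∣≤n; ∣⁅x⁆∣≡1; x∈⁅x⁆; x∈⁅y⁆⇒x≡y; nonempty?; Empty-unique; p⊆q⇒∣p∣≤∣q∣; x∈p⇒∣p-x∣<∣p∣; x∈p∧x≢y⇒x∈p-y; p⊆p∪q; q⊆p∪q; x∈p∪q⁻; x∈p∩q⁺; x∈p∩q⁻; p─q⊆p; x∈p∧x∉q⇒x∈p─q)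
open import Data.Integer.Base as ℤ using (+_)
import Data.Integer.Properties as ℤ
open import Data.List.Base using (List; []; _∷_; allFin)
open import Data.List.Membership.Propositional using () renaming (_∈_ to _∈ₗ_)
open import Data.List.Membership.Propositional.Properties using (∈-allFin)
open import Data.List.Relation.Unary.Any using (here; there)
open import Data.Maybe.Base using (Maybe; just; nothing; maybe′)
import Data.Maybe.Properties as Maybe
open import Data.Nat.Base using (zero; suc; _≤_; _<_; _∸_; z≤n; s≤s)
import Data.Nat.Properties as ℕ
import Data.Nat.Coprimality as Coprime
open import Data.Nat.Solver using (module +-*-Solver)
open import Data.Product using (∃; _,_; proj₁; proj₂)
open import Data.Rational.Base as ℚ using (ℚ; 0ℚ; mkℚ)
import Data.Rational.Properties as ℚₚ
open import Data.Sum.Base using (_⊎_; inj₁; inj₂; [_,_]′; swap)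
open import Data.Vec.Base using ([]; _∷_; here; there; tabulate; _++_)
open import Data.Vec.Properties using (lookup∘tabulate; lookup⇒[]=; []=⇒lookup; lookup-++ˡ; lookup-++ʳ)
import Data.Vec.Functional as Vector
open import Function.Base using (_∘_; const)
open import Algebra.Properties.Semiring.Sum ℕ.+-*-semiring using (sum; *-distribˡ-sum; *-distribʳ-sum)
open import Relation.Nullary using (¬_; Dec; yes; no; does)
open import Relation.Nullary.Decidable using (dec-true; decidable-stable; _×-dec_; _⊎-dec_; ¬?)
open import Relation.Binary.PropositionalEquality as ≡ using (_≡_; _≢_; refl; cong; cong₂; subst; subst₂; trans; module ≡-Reasoning)

module _ {A B : Set} where

  isLeft : A ⊎ B → Bool
  isLeft = [ const true , const false ]′

  isLeft⇒left : ∀ s → isLeft s ≡ true → A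
  isLeft⇒left (inj₁ a) _ = a

  ¬isLeft⇒right : ∀ s → isLeft s ≡ false → B
  ¬isLeft⇒right (inj₂ b) _ = b

-- Finite sets

toSubset : ∀ {n} {P : Fin n → Set} → (∀ v → Dec (P v)) → Subset n
toSubset P? = tabulate (λ v → does (P? v))

module _ {n} {P : Fin n → Set} (P? : ∀ v → Dec (P v)) where

  ∈-toSubset⁺ : ∀ {v} → P v → v ∈ toSubset P?
  ∈-toSubset⁺ {v} pv = lookup⇒[]= v _ (trans (lookup∘tabulate _ v) (dec-true (P? v) pv))

  ∈-toSubset⁻ : ∀ {v} → v ∈ toSubset P? → P v
  ∈-toSubset⁻ {v} v∈ with P? v | trans (≡.sym (lookup∘tabulate _ v)) ([]=⇒lookup v∈)
  ... | yes pv | _ = pv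
  ... | no _   | ()

x∈p─q⇒x∉q : ∀ {n} (p q : Subset n) {x} → x ∈ p ─ q → x ∉ q
x∈p─q⇒x∉q (_ ∷ p) (true  ∷ q) {zero} () _
x∈p─q⇒x∉q (_ ∷ p) (false ∷ q) {zero} _ ()
x∈p─q⇒x∉q (_ ∷ p) (_ ∷ q) {suc x} (there x∈) (there x∈q) = x∈p─q⇒x∉q p q x∈ x∈q

∣p∪q∣≤∣p∣+∣q∣ : ∀ {n} (p q : Subset n) → ∣ p ∪ q ∣ ≤ ∣ p ∣ + ∣ q ∣
∣p∪q∣≤∣p∣+∣q∣ [] [] = z≤n
∣p∪q∣≤∣p∣+∣q∣ (true ∷ p) (false ∷ q) = s≤s (∣p∪q∣≤∣p∣+∣q∣ p q)
∣p∪q∣≤∣p∣+∣q∣ (true ∷ p) (true ∷ q) = s≤s (ℕ.≤-trans (∣p∪q∣≤∣p∣+∣q∣ p q) (ℕ.+-monoʳ-≤ ∣ p ∣ (ℕ.n≤1+n ∣ q ∣)))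
∣p∪q∣≤∣p∣+∣q∣ (false ∷ p) (true ∷ q) = ℕ.≤-trans (s≤s (∣p∪q∣≤∣p∣+∣q∣ p q)) (ℕ.≤-reflexive (≡.sym (ℕ.+-suc ∣ p ∣ ∣ q ∣)))
∣p∪q∣≤∣p∣+∣q∣ (false ∷ p) (false ∷ q) = ∣p∪q∣≤∣p∣+∣q∣ p q

Disjoint : ∀ {n} → Subset n → Subset n → Set
Disjoint p q = ∀ x → x ∈ p → x ∉ q

∣p∣+∣q∣≤∣p∪q∣ : ∀ {n} (p q : Subset n) → Disjoint p q → ∣ p ∣ + ∣ q ∣ ≤ ∣ p ∪ q ∣
∣p∣+∣q∣≤∣p∪q∣ [] [] _ = z≤n
∣p∣+∣q∣≤∣p∪q∣ (true ∷ p) (true ∷ q) p#q = ⊥-elim (p#q zero here here)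
∣p∣+∣q∣≤∣p∪q∣ (true ∷ p) (false ∷ q) p#q = s≤s (∣p∣+∣q∣≤∣p∪q∣ p q (λ x x∈p x∈q → p#q (suc x) (there x∈p) (there x∈q)))
∣p∣+∣q∣≤∣p∪q∣ (false ∷ p) (true ∷ q) p#q = ℕ.≤-trans (ℕ.≤-reflexive (ℕ.+-suc ∣ p ∣ ∣ q ∣)) (s≤s (∣p∣+∣q∣≤∣p∪q∣ p q (λ x x∈p x∈q → p#q (suc x) (there x∈p) (there x∈q))))
∣p∣+∣q∣≤∣p∪q∣ (false ∷ p) (false ∷ q) p#q = ∣p∣+∣q∣≤∣p∪q∣ p q (λ x x∈p x∈q → p#q (suc x) (there x∈p) (there x∈q))

∣p++q∣≡∣p∣+∣q∣ : ∀ {m n} (p : Subset m) (q : Subset n) → ∣ p ++ q ∣ ≡ ∣ p ∣ + ∣ q ∣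
∣p++q∣≡∣p∣+∣q∣ [] q = refl
∣p++q∣≡∣p∣+∣q∣ (true ∷ p) q = cong suc (∣p++q∣≡∣p∣+∣q∣ p q)
∣p++q∣≡∣p∣+∣q∣ (false ∷ p) q = ∣p++q∣≡∣p∣+∣q∣ p q

p⊆q∧∣q∣≤∣p∣⇒q⊆p : ∀ {n} {p q : Subset n} → p ⊆ q → ∣ q ∣ ≤ ∣ p ∣ → q ⊆ p
p⊆q∧∣q∣≤∣p∣⇒q⊆p {p = p} {q} p⊆q ∣q∣≤∣p∣ {x} x∈q with x ∈? p
... | yes x∈p = x∈p
... | no  x∉p = ⊥-elim (ℕ.<⇒≱ (x∈p⇒∣p-x∣<∣p∣ x∈q) (ℕ.≤-trans ∣q∣≤∣p∣ (p⊆q⇒∣p∣≤∣q∣ p⊆q-x)))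
  where
  p⊆q-x : p ⊆ q ─ ⁅ x ⁆
  p⊆q-x {z} z∈p = x∈p∧x≢y⇒x∈p-y (p⊆q z∈p) (λ z≡x → x∉p (subst (_∈ p) z≡x z∈p))

data SplitView (m n : ℕ) : Fin (m + n) → Set where
  left  : ∀ i → SplitView m n (i ↑ˡ n)
  right : ∀ j → SplitView m n (m ↑ʳ j)

splitView : ∀ m n (x : Fin (m + n)) → SplitView m n x
splitView m n x with splitAt m x in eq
... | inj₁ i = subst (SplitView m n) (splitAt⁻¹-↑ˡ eq) (left i)
... | inj₂ j = subst (SplitView m n) (splitAt⁻¹-↑ʳ eq) (right j)

↑ˡ≢↑ʳ : ∀ {m n} (i : Fin m) (j : Fin n) → i ↑ˡ n ≢ m ↑ʳ j
↑ˡ≢↑ʳ {m} {n} i j eq with trans (≡.sym (splitAt-↑ˡ m i n)) (trans (cong (splitAt m) eq) (splitAt-↑ʳ m n j))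
... | ()

∈-++⁺ˡ : ∀ {m n} {p : Subset m} {q : Subset n} {x} → x ∈ p → x ↑ˡ n ∈ p ++ q
∈-++⁺ˡ {p = p} {q} {x} x∈p = lookup⇒[]= _ _ (trans (lookup-++ˡ p q x) ([]=⇒lookup x∈p))

∈-++⁺ʳ : ∀ {m n} {p : Subset m} {q : Subset n} {x} → x ∈ q → m ↑ʳ x ∈ p ++ q
∈-++⁺ʳ {p = p} {q} {x} x∈q = lookup⇒[]= _ _ (trans (lookup-++ʳ p q x) ([]=⇒lookup x∈q))

∈-++⁻ˡ : ∀ {m n} {p : Subset m} {q : Subset n} {x} → x ↑ˡ n ∈ p ++ q → x ∈ p
∈-++⁻ˡ {p = p} {q} {x} x∈ = lookup⇒[]= _ _ (trans (≡.sym (lookup-++ˡ p q x)) ([]=⇒lookup x∈))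

∈-++⁻ʳ : ∀ {m n} {p : Subset m} {q : Subset n} {x} → m ↑ʳ x ∈ p ++ q → x ∈ q
∈-++⁻ʳ {p = p} {q} {x} x∈ = lookup⇒[]= _ _ (trans (≡.sym (lookup-++ʳ p q x)) ([]=⇒lookup x∈))

⋃ᶠ : ∀ {n k} → (Fin k → Subset n) → Subset n
⋃ᶠ = Vector.foldr _∪_ ∅

∈-⋃ᶠ⁺ : ∀ {n k} (f : Fin k → Subset n) i {x} → x ∈ f i → x ∈ ⋃ᶠ f
∈-⋃ᶠ⁺ f zero x∈ = p⊆p∪q (⋃ᶠ (f ∘ suc)) x∈
∈-⋃ᶠ⁺ f (suc i) x∈ = q⊆p∪q (f zero) _ (∈-⋃ᶠ⁺ (f ∘ suc) i x∈)

∈-⋃ᶠ⁻ : ∀ {n k} (f : Fin k → Subset n) {x} → x ∈ ⋃ᶠ f → ∃ λ i → x ∈ f i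
∈-⋃ᶠ⁻ {k = zero} f x∈ = ⊥-elim (∉⊥ x∈)
∈-⋃ᶠ⁻ {k = suc k} f x∈ with x∈p∪q⁻ (f zero) _ x∈
... | inj₁ x∈f₀ = zero , x∈f₀
... | inj₂ x∈⋃ with ∈-⋃ᶠ⁻ (f ∘ suc) x∈⋃
...   | i , x∈fᵢ = suc i , x∈fᵢ

∣⋃ᶠ∣≤sum : ∀ {n k} (f : Fin k → Subset n) → ∣ ⋃ᶠ f ∣ ≤ sum (λ i → ∣ f i ∣)
∣⋃ᶠ∣≤sum {n} {zero} f = ℕ.≤-reflexive (∣⊥∣≡0 n)
∣⋃ᶠ∣≤sum {k = suc k} f =
  ℕ.≤-trans (∣p∪q∣≤∣p∣+∣q∣ (f zero) _) (ℕ.+-monoʳ-≤ ∣ f zero ∣ (∣⋃ᶠ∣≤sum (f ∘ suc)))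

sum≤∣⋃ᶠ∣ : ∀ {n k} (f : Fin k → Subset n) → (∀ i j → i ≢ j → Disjoint (f i) (f j)) →
           sum (λ i → ∣ f i ∣) ≤ ∣ ⋃ᶠ f ∣
sum≤∣⋃ᶠ∣ {k = zero} f _ = z≤n
sum≤∣⋃ᶠ∣ {k = suc k} f disjoint =
  ℕ.≤-trans (ℕ.+-monoʳ-≤ ∣ f zero ∣ (sum≤∣⋃ᶠ∣ (f ∘ suc) (λ i j i≢j → disjoint (suc i) (suc j) (i≢j ∘ suc-injective))))
            (∣p∣+∣q∣≤∣p∪q∣ (f zero) _ f₀#⋃)
  where
  suc-injective : ∀ {i j : Fin k} → suc i ≡ suc j → i ≡ j
  suc-injective refl = refl
  f₀#⋃ : Disjoint (f zero) (⋃ᶠ (f ∘ suc))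
  f₀#⋃ x x∈f₀ x∈⋃ = let (i , x∈fᵢ) = ∈-⋃ᶠ⁻ (f ∘ suc) x∈⋃ in disjoint zero (suc i) (λ ()) x x∈f₀ x∈fᵢ

sum-mono-≤ : ∀ {k} {f g : Fin k → ℕ} → (∀ i → f i ≤ g i) → sum f ≤ sum g
sum-mono-≤ {zero} _ = z≤n
sum-mono-≤ {suc k} f≤g = ℕ.+-mono-≤ (f≤g zero) (sum-mono-≤ (f≤g ∘ suc))

-- Natural numbers against a positive real

ι : ℕ → ℚ
ι k = + k ℚ./ 1

ι≡mkℚ : ∀ k → ι k ≡ mkℚ (+ k) 0 (Coprime.sym (Coprime.1-coprimeTo k))
ι≡mkℚ k = ℚₚ.normalize-coprime (Coprime.sym (Coprime.1-coprimeTo k))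

ι-homo-+ : ∀ a b → ι (a + b) ≡ ι a ℚ.+ ι b
ι-homo-+ a b rewrite ι≡mkℚ a | ι≡mkℚ b = cong (ℚ._/ 1) (begin
    + (a + b)                  ≡⟨ ℤ.pos-+ a b ⟩
    + a ℤ.+ + b                ≡⟨ cong₂ ℤ._+_ (ℤ.*-identityʳ (+ a)) (ℤ.*-identityʳ (+ b)) ⟨
    + a ℤ.* + 1 ℤ.+ + b ℤ.* + 1 ∎)
  where open ≡-Reasoning

ι-homo-* : ∀ a b → ι (a * b) ≡ ι a ℚ.* ι b
ι-homo-* a b rewrite ι≡mkℚ a | ι≡mkℚ b = cong (ℚ._/ 1) (ℤ.pos-* a b)

ι-mono-≤ : ∀ {a b} → a ≤ b → ι a ℚ.≤ ι b
ι-mono-≤ {a} {b} a≤b rewrite ι≡mkℚ a | ι≡mkℚ b =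
  ℚ.*≤* (subst₂ ℤ._≤_ (≡.sym (ℤ.*-identityʳ (+ a))) (≡.sym (ℤ.*-identityʳ (+ b))) (ℤ.+≤+ a≤b))

ι-mono-< : ∀ {a b} → a < b → ι a ℚ.< ι b
ι-mono-< {a} {b} a<b rewrite ι≡mkℚ a | ι≡mkℚ b =
  ℚ.*<* (subst₂ ℤ._<_ (≡.sym (ℤ.*-identityʳ (+ a))) (≡.sym (ℤ.*-identityʳ (+ b))) (ℤ.+<+ a<b))

0≤ι : ∀ k → 0ℚ ℚ.≤ ι k
0≤ι k = ι-mono-≤ {0} {k} z≤n

ι-nonNegative : ∀ k → ℚ.NonNegative (ι k)
ι-nonNegative k = ℚ.nonNegative (0≤ι k)

infix 4 _ʳ≤_

_ʳ≤_ : PosReal → ℕ → Set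
d ʳ≤ x = ∀ e → Lower d e → e ℚ.< ι x

module _ (d : PosReal) where

  lower<upper : ∀ {e u} → Lower d e → Upper d u → e ℚ.< u
  lower<upper {e} {u} e<d d<u with u ℚₚ.≤? e
  ... | no  u≰e = ℚₚ.≰⇒> u≰e
  ... | yes u≤e with lower-open d e e<d
  ...   | e' , e<e' , e'<d = ⊥-elim (disjoint d u (lower-down d e' u (ℚₚ.≤-<-trans u≤e e<e') e'<d) d<u)

  0≤ʳ : 0 ≤ʳ d
  0≤ʳ u d<u = ℚₚ.<⇒≤ (lower<upper (positive d) d<u)

  ≤-≤ʳ-trans : ∀ {x y} → x ≤ y → y ≤ʳ d → x ≤ʳ d
  ≤-≤ʳ-trans x≤y y≤d u d<u = ℚₚ.≤-trans (ι-mono-≤ x≤y) (y≤d u d<u)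

  -- If a < w then a + w < 2w, and locatedness of d picks one of the overlapping cases.
  fits-or-exceeds : ∀ a w → (2 * a) ≤ʳ d → ((a + w) ≤ʳ d) ⊎ (d ʳ≤ 2 * w)
  fits-or-exceeds a w 2a≤d with w ℕ.≤? a
  ... | yes w≤a = inj₁ (≤-≤ʳ-trans (ℕ.+-monoʳ-≤ a (ℕ.≤-trans w≤a (ℕ.m≤m+n a 0))) 2a≤d)
  ... | no  w≰a with located d (ι (a + w)) (ι (2 * w)) (ι-mono-< (ℕ.+-mono-<-≤ (ℕ.≰⇒> w≰a) (ℕ.m≤m+n w 0)))
  ...   | inj₁ a+w<d = inj₁ (λ u d<u → ℚₚ.<⇒≤ (lower<upper a+w<d d<u))
  ...   | inj₂ d<2w = inj₂ (λ e e<d → lower<upper e<d d<2w)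

  0·≤ʳ : ∀ y → 0 · d ≤ʳ y
  0·≤ʳ y e _ = ℚₚ.≤-trans (ℚₚ.≤-reflexive (ℚₚ.*-zeroʳ e)) (0≤ι y)

  ·≤ʳ-+ : ∀ {a b y z} → a · d ≤ʳ y → b · d ≤ʳ z → (a + b) · d ≤ʳ (y + z)
  ·≤ʳ-+ {a} {b} {y} {z} ad≤y bd≤z e e<d = begin
    e ℚ.* ι (a + b)              ≡⟨ cong (e ℚ.*_) (ι-homo-+ a b) ⟩
    e ℚ.* (ι a ℚ.+ ι b)          ≡⟨ ℚₚ.*-distribˡ-+ e (ι a) (ι b) ⟩
    e ℚ.* ι a ℚ.+ e ℚ.* ι b      ≤⟨ ℚₚ.+-mono-≤ (ad≤y e e<d) (bd≤z e e<d) ⟩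
    ι y ℚ.+ ι z                  ≡⟨ ι-homo-+ y z ⟨
    ι (y + z)                    ∎
    where open ℚₚ.≤-Reasoning

  ·≤ʳ-mono : ∀ {a a' y y'} → a' ≤ a → y ≤ y' → a · d ≤ʳ y → a' · d ≤ʳ y'
  ·≤ʳ-mono {a} {a'} {y} {y'} a'≤a y≤y' ad≤y e e<d with ℚₚ.≤-total e 0ℚ
  ... | inj₁ e≤0 = ℚₚ.≤-trans (ℚₚ.*-monoʳ-≤-nonNeg (ι a') {{ι-nonNegative a'}} e≤0)
                     (ℚₚ.≤-trans (ℚₚ.≤-reflexive (ℚₚ.*-zeroˡ (ι a'))) (0≤ι y'))
  ... | inj₂ 0≤e = ℚₚ.≤-trans (ℚₚ.*-monoˡ-≤-nonNeg e {{ℚ.nonNegative 0≤e}} (ι-mono-≤ a'≤a))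
                     (ℚₚ.≤-trans (ad≤y e e<d) (ι-mono-≤ y≤y'))

  ·≤ʳ-sum : ∀ {k} {f g : Fin k → ℕ} → (∀ i → f i · d ≤ʳ g i) → sum f · d ≤ʳ sum g
  ·≤ʳ-sum {zero} _ = 0·≤ʳ 0
  ·≤ʳ-sum {suc k} {f} {g} fd≤g =
    ·≤ʳ-+ {f zero} {sum (f ∘ suc)} {g zero} {sum (g ∘ suc)} (fd≤g zero) (·≤ʳ-sum (fd≤g ∘ suc))

  ʳ≤⇒·≤ʳ : ∀ {x} a → d ʳ≤ x → a · d ≤ʳ (x * a)
  ʳ≤⇒·≤ʳ {x} a d≤x e e<d = ℚₚ.≤-trans (ℚₚ.*-monoʳ-≤-nonNeg (ι a) {{ι-nonNegative a}} (ℚₚ.<⇒≤ (d≤x e e<d)))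
                                     (ℚₚ.≤-reflexive (≡.sym (ι-homo-* x a)))

LossBound-+ : ∀ {L₀ L N Y₀ Y₁ Y} {d : PosReal} {q} → LossBound L₀ Y₀ d q → N · d ≤ʳ Y₁ →
              L ≤ L₀ + N → Y₀ + Y₁ ≤ Y → LossBound L Y d q
LossBound-+ {L₀} {L} {N} {Y₀} {Y₁} {d = d} {q} loss₀ extra L≤ Y₀+Y₁≤Y =
  ·≤ʳ-mono d L∸q≤ Y₀+Y₁≤Y (·≤ʳ-+ d {L₀ ∸ q} {N} {Y₀} {Y₁} loss₀ extra)
  where
  L∸q≤ : L ∸ q ≤ (L₀ ∸ q) + N
  L∸q≤ = ℕ.m≤n+o⇒m∸n≤o L q (ℕ.≤-trans L≤ (ℕ.≤-trans (ℕ.+-monoˡ-≤ N (ℕ.m≤n+m∸n L₀ q))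
                                                     (ℕ.≤-reflexive (ℕ.+-assoc q (L₀ ∸ q) N))))

-- Rooted trees

module Ancestry (T : RootedTree) where

  infix 4 _≼_ _≼?_

  data _≼_ (a : Node T) : Node T → Set where
    self : a ≼ a
    up   : ∀ {t} → a ≼ par T t → a ≼ t

  ≼-trans : ∀ {a b c} → a ≼ b → b ≼ c → a ≼ c
  ≼-trans a≼b self = a≼b
  ≼-trans a≼b (up b≼c) = up (≼-trans a≼b b≼c)

  ⋠-root : ∀ {a} → a ≢ root T → ¬ a ≼ root T
  ⋠-root {a} a≢r = go refl
    where
    go : ∀ {x} → x ≡ root T → ¬ a ≼ x
    go x≡r self = a≢r x≡r
    go x≡r (up a≼px) = go (trans (cong (par T) x≡r) (par-root T)) a≼px

  _≼?_ : ∀ a t → Dec (a ≼ t)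
  a ≼? t = go t (reaches T t)
    where
    go : ∀ t → ReachesRoot (root T) (par T) t → Dec (a ≼ t)
    go t _ with t ≟ a
    go t _ | yes refl = yes self
    go .(root T) here | no r≢a = no (⋠-root (r≢a ∘ ≡.sym))
    go t (step .t _ reach) | no t≢a with go (par T t) reach
    ... | yes a≼pt = yes (up a≼pt)
    ... | no  a⋠pt = no λ { self → t≢a refl ; (up a≼pt) → a⋠pt a≼pt }

  ≼-linear : ∀ {a c s} → a ≼ s → c ≼ s → a ≼ c ⊎ c ≼ a
  ≼-linear self c≼a = inj₂ c≼a
  ≼-linear (up a≼ps) self = inj₁ (up a≼ps)
  ≼-linear (up a≼ps) (up c≼ps) = ≼-linear a≼ps c≼ps

  ≼-antisym : ∀ {a b} → a ≼ b → b ≼ a → a ≡ b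
  ≼-antisym {a} {b} = go b (reaches T b) a
    where
    fixed⇒root : ∀ x → ReachesRoot (root T) (par T) x → par T x ≡ x → x ≡ root T
    fixed⇒root .(root T) here _ = refl
    fixed⇒root x (step .x x≢r reach) px≡x =
      ⊥-elim (x≢r (trans (≡.sym px≡x) (fixed⇒root (par T x) reach (cong (par T) px≡x))))

    go : ∀ s → ReachesRoot (root T) (par T) s → ∀ a → a ≼ s → s ≼ a → a ≡ s
    go .(root T) here a a≼r _ with a ≟ root T
    ... | yes a≡r = a≡r
    ... | no  a≢r = ⊥-elim (⋠-root a≢r a≼r)
    go s (step .s _ _) a self _ = refl
    go s (step .s s≢r reach) a (up a≼ps) s≼a =
      ⊥-elim (s≢r (fixed⇒root s (step s s≢r reach) (≡.sym (go (par T s) reach s (≼-trans s≼a a≼ps) (up self)))))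

  module _ {S : Node T → Set} where

    source : ∀ {a b} → PathIn T S a b → S a
    source (stay _ sa) = sa
    source (move _ _ _ sa _ _) = sa

    infixr 5 _++ₚ_

    _++ₚ_ : ∀ {a b c} → PathIn T S a b → PathIn T S b c → PathIn T S a c
    stay _ _ ++ₚ q = q
    move t t' _ st e p ++ₚ q = move t t' _ st e (p ++ₚ q)

    reverseₚ : ∀ {a b} → PathIn T S a b → PathIn T S b a
    reverseₚ (stay a sa) = stay a sa
    reverseₚ (move t t' _ st e p) = reverseₚ p ++ₚ move t' t t (source p) (swap e) (stay t st)

    leave-subtree : ∀ {a u v} → PathIn T S u v → a ≼ u → ¬ a ≼ v → S a × a ≢ root T × S (par T a)
    leave-subtree (stay _ _) a≼u a⋠v = ⊥-elim (a⋠v a≼u)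
    leave-subtree {a} (move t t' _ st e p) a≼t a⋠v with a ≼? t'
    ... | yes a≼t' = leave-subtree p a≼t' a⋠v
    ... | no  a⋠t' with e
    ...   | inj₁ (_ , pt'≡t) = ⊥-elim (a⋠t' (up (subst (a ≼_) (≡.sym pt'≡t) a≼t)))
    ...   | inj₂ (t≢r , pt≡t') with a≼t
    ...     | self = st , t≢r , subst S (≡.sym pt≡t') (source p)
    ...     | up a≼pt = ⊥-elim (a⋠t' (subst (a ≼_) pt≡t' a≼pt))

  ≼-connected : ∀ a → ConnectedIn T (a ≼_)
  ≼-connected a s s' a≼s a≼s' = path-up a≼s ++ₚ reverseₚ (path-up a≼s')
    where
    path-up : ∀ {s} → a ≼ s → PathIn T (a ≼_) s a
    path-up self = stay _ self
    path-up {s} (up a≼ps) with s ≟ root T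
    ... | yes s≡r = subst (λ z → PathIn T (a ≼_) z a) (trans (cong (par T) s≡r) (trans (par-root T) (≡.sym s≡r))) (path-up a≼ps)
    ... | no  s≢r = move s (par T s) a (up a≼ps) (inj₂ (s≢r , refl)) (path-up a≼ps)

-- The top bag of a vertex

module TopBag {n} {E : Adj n} (D : TreeDecomp E) where

  open Ancestry (tree D) public

  IsTop : Fin n → Node (tree D) → Set
  IsTop v t = v ∈ bag D t × (t ≡ root (tree D) ⊎ v ∉ bag D (par (tree D) t))

  IsTop⇒≼ : ∀ {v t} → IsTop v t → ∀ {s} → v ∈ bag D s → t ≼ s
  IsTop⇒≼ {v} {t} (v∈t , t-top) {s} v∈s with t ≼? s
  ... | yes t≼s = t≼s
  ... | no  t⋠s with leave-subtree (conn D v t s v∈t v∈s) self t⋠s | t-top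
  ...   | _ , t≢r , _ | inj₁ t≡r = ⊥-elim (t≢r t≡r)
  ...   | _ , _ , v∈pt | inj₂ v∉pt = ⊥-elim (v∉pt v∈pt)

  abstract
    ∃-top : ∀ v → Σ (Node (tree D)) (IsTop v)
    ∃-top v = climb (proj₁ (cover D v)) (reaches (tree D) _) (proj₂ (cover D v))
      where
      climb : ∀ s → ReachesRoot (root (tree D)) (par (tree D)) s → v ∈ bag D s → Σ (Node (tree D)) (IsTop v)
      climb .(root (tree D)) here v∈s = root (tree D) , v∈s , inj₁ refl
      climb s (step .s _ reach) v∈s with v ∈? bag D (par (tree D) s)
      ... | yes v∈ps = climb (par (tree D) s) reach v∈ps
      ... | no  v∉ps = s , v∈s , inj₂ v∉ps

  top : Fin n → Node (tree D)
  top v = proj₁ (∃-top v)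

  top-isTop : ∀ v → IsTop v (top v)
  top-isTop v = proj₂ (∃-top v)

  ∈-bag-top : ∀ v → v ∈ bag D (top v)
  ∈-bag-top v = proj₁ (top-isTop v)

  top-≼ : ∀ v {s} → v ∈ bag D s → top v ≼ s
  top-≼ v = IsTop⇒≼ (top-isTop v)

  module _ {C : Subset n} (clique : ∀ i j → i ∈ C → j ∈ C → i ≢ j → E i j) where

    -- Adjacent vertices share a bag, so their tops are ≼-comparable (Helly property of subtrees).
    deepest-top : ∀ {x₀} → x₀ ∈ C → (L : List (Fin n)) →
                  ∃ λ x → x ∈ C × (∀ y → y ∈ C → y ∈ₗ L → top y ≼ top x)
    deepest-top {x₀} x₀∈C [] = x₀ , x₀∈C , λ _ _ ()
    deepest-top x₀∈C (z ∷ L) with deepest-top x₀∈C L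
    ... | x , x∈C , deepest with z ∈? C
    ...   | no  z∉C = x , x∈C , λ { y y∈C (here refl) → ⊥-elim (z∉C y∈C) ; y y∈C (there y∈L) → deepest y y∈C y∈L }
    ...   | yes z∈C with z ≟ x
    ...     | yes refl = x , x∈C , λ { y _ (here refl) → self ; y y∈C (there y∈L) → deepest y y∈C y∈L }
    ...     | no  z≢x with edge D x z (clique x z x∈C z∈C (z≢x ∘ ≡.sym))
    ...       | s , x∈s , z∈s with ≼-linear (top-≼ x x∈s) (top-≼ z z∈s)
    ...         | inj₁ tx≼tz = z , z∈C , λ { y _ (here refl) → self ; y y∈C (there y∈L) → ≼-trans (deepest y y∈C y∈L) tx≼tz }
    ...         | inj₂ tz≼tx = x , x∈C , λ { y _ (here refl) → tz≼tx ; y y∈C (there y∈L) → deepest y y∈C y∈L }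

    ∈-bag-deeper-top : ∀ {x y} → x ∈ C → y ∈ C → top y ≼ top x → y ∈ bag D (top x)
    ∈-bag-deeper-top {x} {y} x∈C y∈C ty≼tx with y ≟ x
    ... | yes refl = ∈-bag-top y
    ... | no  y≢x with edge D x y (clique x y x∈C y∈C (y≢x ∘ ≡.sym))
    ...   | s , x∈s , y∈s with top x ≼? top y
    ...     | yes tx≼ty = subst (λ f → y ∈ bag D f) (≼-antisym ty≼tx tx≼ty) (∈-bag-top y)
    ...     | no  tx⋠ty = proj₁ (leave-subtree (conn D y s (top y) y∈s (∈-bag-top y)) (top-≼ x x∈s) tx⋠ty)

    clique⊆bag-top : ∀ {x₀} → x₀ ∈ C → ∃ λ x → x ∈ C × C ⊆ bag D (top x)
    clique⊆bag-top x₀∈C with deepest-top x₀∈C (allFin n)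
    ... | x , x∈C , deepest = x , x∈C , λ {y} y∈C → ∈-bag-deeper-top x∈C y∈C (deepest y y∈C (∈-allFin y))

    clique⊆bag : ∃ λ f → C ⊆ bag D f
    clique⊆bag with nonempty? C
    ... | yes (x₀ , x₀∈C) = let (x , _ , C⊆) = clique⊆bag-top x₀∈C in top x , C⊆
    ... | no  C-empty = root (tree D) , λ {y} y∈C → ⊥-elim (C-empty (y , y∈C))

-- Attaching leaves to a tree-decomposition

module LeafExtension {p k b : ℕ} {E : Adj p} (D : TreeDecomp E) (narrow : ∀ f → ∣ bag D f ∣ ≤ suc b)
                     (attach : Fin k → Node (tree D)) (B : Fin k → Subset p)
                     (B⊆ : ∀ t → B t ⊆ bag D (attach t)) (∣B∣≤b : ∀ t → ∣ B t ∣ ≤ b) where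

  private
    s : ℕ
    s = size (tree D)

  old : Node (tree D) → Fin (s + k)
  old f = f ↑ˡ k

  leaf : Fin k → Fin (s + k)
  leaf t = s ↑ʳ t

  private
    par⁺ : Fin (s + k) → Fin (s + k)
    par⁺ x = [ old ∘ par (tree D) , old ∘ attach ]′ (splitAt s x)

    par⁺-old : ∀ f → par⁺ (old f) ≡ old (par (tree D) f)
    par⁺-old f = cong [ old ∘ par (tree D) , old ∘ attach ]′ (splitAt-↑ˡ s f k)

    par⁺-leaf : ∀ t → par⁺ (leaf t) ≡ old (attach t)
    par⁺-leaf t = cong [ old ∘ par (tree D) , old ∘ attach ]′ (splitAt-↑ʳ s k t)

    reaches-old : ∀ {f} → ReachesRoot (root (tree D)) (par (tree D)) f → ReachesRoot (old (root (tree D))) par⁺ (old f)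
    reaches-old here = here
    reaches-old {f} (step .f f≢r reach) =
      step (old f) (f≢r ∘ ↑ˡ-injective k _ _) (subst (ReachesRoot _ par⁺) (≡.sym (par⁺-old f)) (reaches-old reach))

    reaches⁺ : ∀ x → SplitView s k x → ReachesRoot (old (root (tree D))) par⁺ x
    reaches⁺ .(old f) (left f) = reaches-old (reaches (tree D) f)
    reaches⁺ .(leaf t) (right t) =
      step (leaf t) (↑ˡ≢↑ʳ (root (tree D)) t ∘ ≡.sym)
           (subst (ReachesRoot _ par⁺) (≡.sym (par⁺-leaf t)) (reaches-old (reaches (tree D) (attach t))))

  tree⁺ : RootedTree
  tree⁺ = record
    { size     = s + k
    ; root     = old (root (tree D))
    ; par      = par⁺
    ; par-root = trans (par⁺-old (root (tree D))) (cong old (par-root (tree D)))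
    ; reaches  = λ x → reaches⁺ x (splitView s k x)
    }

  private
    leaf-edge : ∀ t → TEdge tree⁺ (leaf t) (old (attach t))
    leaf-edge t = inj₂ (↑ˡ≢↑ʳ (root (tree D)) t ∘ ≡.sym , par⁺-leaf t)

    old-edge : ∀ {f f'} → TEdge (tree D) f f' → TEdge tree⁺ (old f) (old f')
    old-edge (inj₁ (f'≢r , pf'≡f)) = inj₁ (f'≢r ∘ ↑ˡ-injective k _ _ , trans (par⁺-old _) (cong old pf'≡f))
    old-edge (inj₂ (f≢r , pf≡f')) = inj₂ (f≢r ∘ ↑ˡ-injective k _ _ , trans (par⁺-old _) (cong old pf≡f'))

    old-path : ∀ {S : Node (tree D) → Set} {S⁺ : Node tree⁺ → Set} → (∀ f → S f → S⁺ (old f)) →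
               ∀ {f f'} → PathIn (tree D) S f f' → PathIn tree⁺ S⁺ (old f) (old f')
    old-path S⇒S⁺ (stay f sf) = stay _ (S⇒S⁺ f sf)
    old-path S⇒S⁺ (move f f' _ sf e rest) = move _ _ _ (S⇒S⁺ f sf) (old-edge e) (old-path S⇒S⁺ rest)

  -- Old vertex y is y ↑ˡ k; the new vertex p ↑ʳ t lies only in the bag of leaf t.
  bag⁺ : Node tree⁺ → Subset (p + k)
  bag⁺ x = [ (λ f → bag D f ++ ∅) , (λ t → B t ++ ⁅ t ⁆) ]′ (splitAt s x)

  private
    bag⁺-old : ∀ f → bag⁺ (old f) ≡ bag D f ++ ∅
    bag⁺-old f = cong [ (λ f → bag D f ++ ∅) , (λ t → B t ++ ⁅ t ⁆) ]′ (splitAt-↑ˡ s f k)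

    bag⁺-leaf : ∀ t → bag⁺ (leaf t) ≡ B t ++ ⁅ t ⁆
    bag⁺-leaf t = cong [ (λ f → bag D f ++ ∅) , (λ t → B t ++ ⁅ t ⁆) ]′ (splitAt-↑ʳ s k t)

  ∈-bag⁺-old : ∀ {y f} → y ∈ bag D f → y ↑ˡ k ∈ bag⁺ (old f)
  ∈-bag⁺-old {y} {f} y∈ = subst (y ↑ˡ k ∈_) (≡.sym (bag⁺-old f)) (∈-++⁺ˡ y∈)

  ∈-bag⁺-leaf : ∀ {y t} → y ∈ B t → y ↑ˡ k ∈ bag⁺ (leaf t)
  ∈-bag⁺-leaf {y} {t} y∈ = subst (y ↑ˡ k ∈_) (≡.sym (bag⁺-leaf t)) (∈-++⁺ˡ y∈)

  new∈bag⁺-leaf : ∀ t → p ↑ʳ t ∈ bag⁺ (leaf t)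
  new∈bag⁺-leaf t = subst (p ↑ʳ t ∈_) (≡.sym (bag⁺-leaf t)) (∈-++⁺ʳ (x∈⁅x⁆ t))

  private
    old-home : ∀ y x → SplitView s k x → y ↑ˡ k ∈ bag⁺ x →
               ∃ λ f → y ∈ bag D f × PathIn tree⁺ (λ x → y ↑ˡ k ∈ bag⁺ x) x (old f)
    old-home y .(old f) (left f) y∈ = f , ∈-++⁻ˡ (subst (y ↑ˡ k ∈_) (bag⁺-old f) y∈) , stay _ y∈
    old-home y .(leaf t) (right t) y∈ =
      let y∈att = B⊆ t (∈-++⁻ˡ (subst (y ↑ˡ k ∈_) (bag⁺-leaf t) y∈))
      in attach t , y∈att , move _ _ _ y∈ (leaf-edge t) (stay _ (∈-bag⁺-old y∈att))

    new-home : ∀ t x → SplitView s k x → p ↑ʳ t ∈ bag⁺ x → x ≡ leaf t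
    new-home t .(old f) (left f) t∈ = ⊥-elim (∉⊥ (∈-++⁻ʳ {p = bag D f} (subst (p ↑ʳ t ∈_) (bag⁺-old f) t∈)))
    new-home t .(leaf t') (right t') t∈ =
      cong leaf (≡.sym (x∈⁅y⁆⇒x≡y t' (∈-++⁻ʳ {p = B t'} (subst (p ↑ʳ t ∈_) (bag⁺-leaf t') t∈))))

    connected : ∀ i → SplitView p k i → ConnectedIn tree⁺ (λ x → i ∈ bag⁺ x)
    connected .(y ↑ˡ k) (left y) x x' y∈x y∈x'
      with old-home y x (splitView s k x) y∈x | old-home y x' (splitView s k x') y∈x'
    ... | f , y∈f , x→f | f' , y∈f' , x'→f' =
      x→f ++ₚ old-path (λ _ → ∈-bag⁺-old) (conn D y f f' y∈f y∈f') ++ₚ reverseₚ x'→f'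
      where open Ancestry tree⁺
    connected .(p ↑ʳ t) (right t) x x' t∈x t∈x' =
      subst₂ (PathIn tree⁺ _) (≡.sym (new-home t x (splitView s k x) t∈x))
             (≡.sym (new-home t x' (splitView s k x') t∈x')) (stay _ (new∈bag⁺-leaf t))

    covered : ∀ i → SplitView p k i → ∃ λ x → i ∈ bag⁺ x
    covered .(y ↑ˡ k) (left y) = let (f , y∈f) = cover D y in old f , ∈-bag⁺-old y∈f
    covered .(p ↑ʳ t) (right t) = leaf t , new∈bag⁺-leaf t

    narrow⁺ : ∀ x → SplitView s k x → ∣ bag⁺ x ∣ ≤ suc b
    narrow⁺ .(old f) (left f) rewrite bag⁺-old f | ∣p++q∣≡∣p∣+∣q∣ (bag D f) (∅ {k}) | ∣⊥∣≡0 k | ℕ.+-identityʳ ∣ bag D f ∣ = narrow f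
    narrow⁺ .(leaf t) (right t) rewrite bag⁺-leaf t | ∣p++q∣≡∣p∣+∣q∣ (B t) ⁅ t ⁆ | ∣⁅x⁆∣≡1 t | ℕ.+-comm ∣ B t ∣ 1 = s≤s (∣B∣≤b t)

  treewidth-≤ : (E⁺ : Adj (p + k)) → (∀ i j → E⁺ i j → ∃ λ x → i ∈ bag⁺ x × j ∈ bag⁺ x) → TreewidthAtMost E⁺ b
  treewidth-≤ E⁺ edge⁺ =
    record { tree = tree⁺ ; bag = bag⁺ ; cover = λ i → covered i (splitView p k i)
           ; edge = edge⁺ ; conn = λ i → connected i (splitView p k i) } ,
    λ x → narrow⁺ x (splitView s k x)

-- Branches of a rooted tree-decomposition

module Branches {n} (G : Graph n) (D : TreeDecomp (E G)) where

  open RTD G D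
  open TopBag D public

  r : Node T
  r = root T

  ChildOfRoot : Node T → Set
  ChildOfRoot = Child T r

  K-root : K r ≡ ∅
  K-root with r ≟ r
  ... | yes _ = refl
  ... | no r≢r = ⊥-elim (r≢r refl)

  K-nonroot : ∀ {t} → t ≢ r → K t ≡ J t ∩ J (par T t)
  K-nonroot {t} t≢r with t ≟ r
  ... | yes t≡r = ⊥-elim (t≢r t≡r)
  ... | no  _ = refl

  ∈K-child : ∀ {t u} → ChildOfRoot t → u ∈ J t → u ∈ J r → u ∈ K t ─ K r
  ∈K-child {t} {u} (t≢r , pt≡r) u∈t u∈r =
    x∈p∧x∉q⇒x∈p─q (subst (u ∈_) (≡.sym (K-nonroot t≢r)) (x∈p∩q⁺ (u∈t , subst (λ z → u ∈ J z) (≡.sym pt≡r) u∈r)))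
                  (∉⊥ ∘ subst (u ∈_) K-root)

  J⁻⇒IsTop : ∀ {v s} → v ∈ J⁻ s → IsTop v s
  J⁻⇒IsTop {v} {s} v∈ = v∈s , root-or-top (s ≟ r)
    where
    v∈s : v ∈ J s
    v∈s = p─q⊆p (J s) (K s) v∈

    root-or-top : Dec (s ≡ r) → s ≡ r ⊎ v ∉ J (par T s)
    root-or-top (yes s≡r) = inj₁ s≡r
    root-or-top (no  s≢r) = inj₂ λ v∈ps →
      x∈p─q⇒x∉q (J s) (K s) v∈ (subst (v ∈_) (≡.sym (K-nonroot s≢r)) (x∈p∩q⁺ (v∈s , v∈ps)))

  IsTop⇒J⁻ : ∀ {v s} → IsTop v s → v ∈ J⁻ s
  IsTop⇒J⁻ {v} {s} (v∈s , s-top) = x∈p∧x∉q⇒x∈p─q v∈s (v∉K (s ≟ r) s-top)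
    where
    v∉K : Dec (s ≡ r) → s ≡ r ⊎ v ∉ J (par T s) → v ∉ K s
    v∉K (yes s≡r) _ v∈K = ∉⊥ (subst (v ∈_) (trans (cong K s≡r) K-root) v∈K)
    v∉K (no  s≢r) (inj₁ s≡r) _ = s≢r s≡r
    v∉K (no  s≢r) (inj₂ v∉ps) v∈K = v∉ps (proj₂ (x∈p∩q⁻ (J s) (J (par T s)) (subst (v ∈_) (K-nonroot s≢r) v∈K)))

  ∈J-root⇒top≡root : ∀ {v} → v ∈ J r → top v ≡ r
  ∈J-root⇒top≡root {v} v∈r with top v ≟ r
  ... | yes t≡r = t≡r
  ... | no  t≢r = ⊥-elim (⋠-root t≢r (top-≼ v v∈r))

  private
    child-≼-child : ∀ {c c'} → ChildOfRoot c → ChildOfRoot c' → c ≼ c' → c ≡ c'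
    child-≼-child _ _ self = refl
    child-≼-child {c} (c≢r , _) (_ , pc'≡r) (up c≼pc') = ⊥-elim (⋠-root c≢r (subst (c ≼_) pc'≡r c≼pc'))

  children-≼-unique : ∀ {c c' s} → ChildOfRoot c → ChildOfRoot c' → c ≼ s → c' ≼ s → c ≡ c'
  children-≼-unique ch ch' c≼s c'≼s with ≼-linear c≼s c'≼s
  ... | inj₁ c≼c' = child-≼-child ch ch' c≼c'
  ... | inj₂ c'≼c = ≡.sym (child-≼-child ch' ch c'≼c)

  private
    branchOf : ∀ s → ReachesRoot r (par T) s → Node T
    branchOf .(root T) here = r
    branchOf s (step .s _ reach) with par T s ≟ r
    ... | yes _ = s
    ... | no  _ = branchOf (par T s) reach

    branchOf-≼ : ∀ s reach → branchOf s reach ≼ s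
    branchOf-≼ .(root T) here = self
    branchOf-≼ s (step .s _ reach) with par T s ≟ r
    ... | yes _ = self
    ... | no  _ = up (branchOf-≼ (par T s) reach)

    branchOf-child : ∀ s reach → s ≢ r → ChildOfRoot (branchOf s reach)
    branchOf-child .(root T) here r≢r = ⊥-elim (r≢r refl)
    branchOf-child s (step .s s≢r reach) _ with par T s ≟ r
    ... | yes ps≡r = s≢r , ps≡r
    ... | no  ps≢r = branchOf-child (par T s) reach ps≢r

    branchOf-root : ∀ reach → branchOf r reach ≡ r
    branchOf-root here = refl
    branchOf-root (step .(root T) r≢r _) = ⊥-elim (r≢r refl)

  branch : Node T → Node T
  branch s = branchOf s (reaches T s)

  branch-≼ : ∀ s → branch s ≼ s
  branch-≼ s = branchOf-≼ s (reaches T s)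

  branch-child : ∀ {s} → s ≢ r → ChildOfRoot (branch s)
  branch-child {s} = branchOf-child s (reaches T s)

  branch-root : branch r ≡ r
  branch-root = branchOf-root (reaches T r)

  branch-unique : ∀ {c s} → ChildOfRoot c → c ≼ s → branch s ≡ c
  branch-unique {c} {s} ch c≼s with s ≟ r
  ... | yes s≡r = ⊥-elim (⋠-root (proj₁ ch) (subst (c ≼_) s≡r c≼s))
  ... | no  s≢r = children-≼-unique (branch-child s≢r) ch (branch-≼ s) c≼s

  owner : Fin n → Node T
  owner v = branch (top v)

  owner-≼ : ∀ v → owner v ≼ top v
  owner-≼ v = branch-≼ (top v)

  owner≡root⇒∈J-root : ∀ {v} → owner v ≡ r → v ∈ J r
  owner≡root⇒∈J-root {v} o≡r with top v ≟ r
  ... | yes t≡r = subst (λ z → v ∈ J z) t≡r (∈-bag-top v)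
  ... | no  t≢r = ⊥-elim (proj₁ (branch-child t≢r) o≡r)

  ∈J-root⇒owner≡root : ∀ {v} → v ∈ J r → owner v ≡ r
  ∈J-root⇒owner≡root v∈r = trans (cong branch (∈J-root⇒top≡root v∈r)) branch-root

  owner-child : ∀ {v} → owner v ≢ r → ChildOfRoot (owner v)
  owner-child {v} o≢r with top v ≟ r
  ... | yes t≡r = ⊥-elim (o≢r (trans (cong branch t≡r) branch-root))
  ... | no  t≢r = branch-child t≢r

  edge-leaving-branch : ∀ {u v} → E G u v → owner u ≢ r → owner v ≢ owner u → v ∈ J (owner u) × v ∈ J r
  edge-leaving-branch {u} {v} uv ou≢r ov≢ou with edge D u v uv
  ... | s , u∈s , v∈s
    with leave-subtree (conn D v s (top v) v∈s (∈-bag-top v)) (≼-trans (owner-≼ u) (top-≼ u u∈s))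
                       (ov≢ou ∘ branch-unique (owner-child ou≢r))
  ...   | v∈ou , _ , v∈p = v∈ou , subst (λ z → v ∈ J z) (proj₂ (owner-child ou≢r)) v∈p

  below : Node T → Subset n
  below c = toSubset (λ v → c ≼? top v)

  below-weight : ∀ {d} → NearWeightAtMost d → ∀ {c} → c ≢ r → ∣ below c ∣ ≤ʳ d
  below-weight near-weight {c} c≢r = near-weight (c ≼_) (⋠-root c≢r) (≼-connected c) (below c) λ v →
    (λ v∈ → top v , ∈-toSubset⁻ (λ v → c ≼? top v) v∈ , IsTop⇒J⁻ (top-isTop v)) ,
    (λ { (s , c≼s , v∈s) → ∈-toSubset⁺ (λ v → c ≼? top v)
                             (≼-trans c≼s (IsTop⇒≼ (J⁻⇒IsTop v∈s) (∈-bag-top v))) })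

-- The construction

module Construction (b m c q n : ℕ) (d : PosReal) (G : Graph n) (D : TreeDecomp (E G))
                    (near-weight : RTD.NearWeightAtMost G D d)
                    (H : RTD.HalfDecompAt G D b m d c q (root (tree D))) where

  open RTD G D
  open Branches G D
  open HalfDecompAt H

  𝒫 : Partition (J⁻ r ─ X ap)
  𝒫 = parts ap

  p : ℕ
  p = nparts 𝒫

  part⊆ : ∀ {i v} → v ∈ part 𝒫 i → v ∈ J r × v ∉ X ap
  part⊆ {i} v∈i = p─q⊆p (J r) (K r) (p─q⊆p (J⁻ r) (X ap) (inside 𝒫 i v∈i)) , x∈p─q⇒x∉q (J⁻ r) (X ap) (inside 𝒫 i v∈i)

  meets? : ∀ t i → Dec (∃ λ v → v ∈ J t × v ∈ part 𝒫 i)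
  meets? t i = any? (λ v → (v ∈? J t) ×-dec (v ∈? part 𝒫 i))

  partsMeeting : Node T → Subset p
  partsMeeting t = toSubset (meets? t)

  ∈-partsMeeting : ∀ {t i v} → v ∈ J t → v ∈ part 𝒫 i → i ∈ partsMeeting t
  ∈-partsMeeting {t} {v = v} v∈t v∈i = ∈-toSubset⁺ (meets? t) (v , v∈t , v∈i)

  partsMeeting-clique : ∀ {t} → ChildOfRoot t → QClique (TorsoAdj r) 𝒫 (partsMeeting t)
  partsMeeting-clique {t} ch i j i∈ j∈ i≢j with ∈-toSubset⁻ (meets? t) i∈ | ∈-toSubset⁻ (meets? t) j∈
  ... | u , u∈t , u∈i | v , v∈t , v∈j =
    i≢j , u , v , u∈i , v∈j , inj₂ (u≢v , t , inj₁ ch , proj₁ (part⊆ u∈i) , u∈t , proj₁ (part⊆ v∈j) , v∈t)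
    where
    u≢v : u ≢ v
    u≢v u≡v = disj 𝒫 i j i≢j v (subst (_∈ part 𝒫 i) u≡v u∈i) v∈j

  D𝒫 : TreeDecomp (QAdj (TorsoAdj r) 𝒫)
  D𝒫 = proj₁ tw

  module Quotient = TopBag D𝒫

  Big : Node T → Set
  Big t = ChildOfRoot t × b < ∣ partsMeeting t ∣

  Targets : Node T → Fin p → Set
  Targets t y = Big t × y ∈ partsMeeting t × partsMeeting t ⊆ bag D𝒫 (Quotient.top y)

  bag-top⊆partsMeeting : ∀ {t y} → Targets t y → bag D𝒫 (Quotient.top y) ⊆ partsMeeting t
  bag-top⊆partsMeeting ((_ , big) , _ , ⊆bag) = p⊆q∧∣q∣≤∣p∣⇒q⊆p ⊆bag (ℕ.≤-trans (proj₂ tw _) big)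

  ChildOfRoot? : ∀ t → Dec (ChildOfRoot t)
  ChildOfRoot? t = ¬? (t ≟ r) ×-dec (par T t ≟ r)

  private
    nonempty-if-big : ∀ {t} → b < ∣ partsMeeting t ∣ → Nonempty (partsMeeting t)
    nonempty-if-big {t} big with nonempty? (partsMeeting t)
    ... | yes ne = ne
    ... | no  empty = ⊥-elim (ℕ.n≮0 (subst (b <_) (trans (cong ∣_∣ (Empty-unique empty)) (∣⊥∣≡0 p)) big))

    target-or-small : ∀ t → (∃ λ y → Targets t y) ⊎ ¬ Big t
    target-or-small t with ChildOfRoot? t
    ... | no ¬ch = inj₂ (¬ch ∘ proj₁)
    ... | yes ch with b ℕ.<? ∣ partsMeeting t ∣
    ...   | no  ¬big = inj₂ (¬big ∘ proj₂)
    ...   | yes big with Quotient.clique⊆bag-top (partsMeeting-clique ch) (proj₂ (nonempty-if-big big))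
    ...     | y , y∈ , ⊆bag = inj₁ (y , (ch , big) , y∈ , ⊆bag)

  abstract
    target : Node T → Maybe (Fin p)
    target t = [ just ∘ proj₁ , const nothing ]′ (target-or-small t)

    target-just : ∀ {t y} → target t ≡ just y → Targets t y
    target-just {t} with target-or-small t
    ... | inj₁ (y , spec) = λ { refl → spec }
    ... | inj₂ _ = λ ()

    target-nothing : ∀ {t} → target t ≡ nothing → ¬ Big t
    target-nothing {t} with target-or-small t
    ... | inj₁ _ = λ ()
    ... | inj₂ small = λ _ → small

  target≢root : ∀ {t y} → target t ≡ just y → t ≢ r
  target≢root e = proj₁ (proj₁ (proj₁ (target-just e)))

  _meetsOnly_ : Subset n → Subset p → Set
  A meetsOnly B = ∀ i v → v ∈ A → v ∈ part 𝒫 i → i ∈ B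

  GroupSeparator : Fin p → Set
  GroupSeparator y = ∃ λ S → ∣ S ∣ ≤ m ×
    (∀ t → target t ≡ just y → ∃ λ B → B ⊆ bag D𝒫 (Quotient.top y) × ∣ B ∣ ≤ b × (J t ─ S) meetsOnly B)

  private
    member-separated : ∀ {y t₀} → Targets t₀ y → ∀ S → (∀ K' → 𝒦 K' → MeetsAtMost 𝒫 (K' ─ S) b (partsMeeting t₀)) →
                       ∀ {t} → target t ≡ just y →
                       ∃ λ B → B ⊆ bag D𝒫 (Quotient.top y) × ∣ B ∣ ≤ b × (J t ─ S) meetsOnly B
    member-separated spec₀@(_ , _ , Q₀⊆bag) S meets {t} e with target-just e
    ... | (ch , _) , _ , Q⊆bag with meets (K t ─ K r) (𝒦-child t ch)
    ...   | B , B⊆Q₀ , ∣B∣≤b , meets-B = B , (λ i∈B → Q₀⊆bag (B⊆Q₀ i∈B)) , ∣B∣≤b , only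
      where
      only : (J t ─ S) meetsOnly B
      only i v v∈ v∈i =
        let v∈t = p─q⊆p (J t) S v∈
        in meets-B i (bag-top⊆partsMeeting spec₀ (Q⊆bag (∈-partsMeeting v∈t v∈i)))
                     (v , x∈p∧x∉q⇒x∈p─q (∈K-child ch v∈t (proj₁ (part⊆ v∈i))) (x∈p─q⇒x∉q (J t) S v∈) , v∈i)

  -- All members of a group meet exactly the parts in the bag of the top of y,
  -- so one concentration set, taken for any member, serves the whole group.
  groupSeparator : ∀ y → GroupSeparator y
  groupSeparator y with any? (λ t → Maybe.≡-dec _≟_ (target t) (just y))
  ... | no  none = ∅ , ℕ.≤-trans (ℕ.≤-reflexive (∣⊥∣≡0 n)) z≤n , λ t e → ⊥-elim (none (t , e))
  ... | yes (t₀ , e₀) with target-just e₀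
  ...   | spec₀@((ch₀ , _) , _) with conc (partsMeeting t₀) (partsMeeting-clique ch₀)
  ...     | S , ∣S∣≤m , meets = S , ∣S∣≤m , λ t → member-separated spec₀ S meets

  branchesOf : Fin p → Subset n
  branchesOf y = toSubset (λ v → Maybe.≡-dec _≟_ (target (owner v)) (just y))

  ∈-branchesOf : ∀ {v y} → v ∈ branchesOf y → target (owner v) ≡ just y
  ∈-branchesOf {y = y} = ∈-toSubset⁻ (λ v → Maybe.≡-dec _≟_ (target (owner v)) (just y))

  branchesOf-∋ : ∀ {v y} → target (owner v) ≡ just y → v ∈ branchesOf y
  branchesOf-∋ {y = y} = ∈-toSubset⁺ (λ v → Maybe.≡-dec _≟_ (target (owner v)) (just y))

  abstract
    merge-choice : ∀ y → ((∣ part 𝒫 y ∣ + ∣ branchesOf y ∣) ≤ʳ d) ⊎ (d ʳ≤ 2 * ∣ branchesOf y ∣)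
    merge-choice y = fits-or-exceeds d ∣ part 𝒫 y ∣ ∣ branchesOf y ∣ (width y)

  merged : Fin p → Bool
  merged y = isLeft (merge-choice y)

  merged-fits : ∀ {y} → merged y ≡ true → (∣ part 𝒫 y ∣ + ∣ branchesOf y ∣) ≤ʳ d
  merged-fits {y} = isLeft⇒left (merge-choice y)

  unmerged-exceeds : ∀ {y} → merged y ≡ false → d ʳ≤ 2 * ∣ branchesOf y ∣
  unmerged-exceeds {y} = ¬isLeft⇒right (merge-choice y)

  separate : Node T → Bool
  separate t = maybe′ (not ∘ merged) true (target t)

  separate⇒unmerged : ∀ {t y} → target t ≡ just y → separate t ≡ true → merged y ≡ false
  separate⇒unmerged {t} e sep = Bool.not-injective (subst (λ z → maybe′ (not ∘ merged) true z ≡ true) e sep)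

  ¬separate⇒merged : ∀ t → separate t ≢ true → ∃ λ y → target t ≡ just y × merged y ≡ true
  ¬separate⇒merged t ¬sep = from-target (target t) refl
    where
    from-target : ∀ o → target t ≡ o → ∃ λ y → target t ≡ just y × merged y ≡ true
    from-target nothing  e = ⊥-elim (¬sep (cong (maybe′ (not ∘ merged) true) e))
    from-target (just y) e = y , e , Bool.not-injective (Bool.¬-not (¬sep ∘ trans (cong (maybe′ (not ∘ merged) true) e)))

  deleted : Fin p → Subset n
  deleted y = if merged y then ∅ else proj₁ (groupSeparator y)

  X⁺ : Subset n
  X⁺ = X ap ∪ ⋃ᶠ deleted

  separator⊆X⁺ : ∀ {y} → merged y ≡ false → proj₁ (groupSeparator y) ⊆ X⁺
  separator⊆X⁺ {y} unmerged {v} v∈S =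
    q⊆p∪q (X ap) _ (∈-⋃ᶠ⁺ deleted y (subst (λ z → v ∈ (if z then ∅ else proj₁ (groupSeparator y))) (≡.sym unmerged) v∈S))

  k : ℕ
  k = size T

  Enlarged : Fin p → Fin n → Set
  Enlarged y v = v ∉ X⁺ × (v ∈ part 𝒫 y ⊎ merged y ≡ true × v ∈ branchesOf y)

  OwnPart : Node T → Fin n → Set
  OwnPart t v = v ∉ X⁺ × owner v ≡ t × t ≢ r × separate t ≡ true

  enlarged? : ∀ y v → Dec (Enlarged y v)
  enlarged? y v = ¬? (v ∈? X⁺) ×-dec ((v ∈? part 𝒫 y) ⊎-dec ((merged y Bool.≟ true) ×-dec (v ∈? branchesOf y)))

  ownPart? : ∀ t v → Dec (OwnPart t v)
  ownPart? t v = ¬? (v ∈? X⁺) ×-dec ((owner v ≟ t) ×-dec (¬? (t ≟ r) ×-dec (separate t Bool.≟ true)))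

  abstract
    enlarged : Fin p → Subset n
    enlarged y = toSubset (enlarged? y)

    ∈-enlarged : ∀ {y v} → v ∈ enlarged y → Enlarged y v
    ∈-enlarged {y} = ∈-toSubset⁻ (enlarged? y)

    enlarged-∋ : ∀ {y v} → Enlarged y v → v ∈ enlarged y
    enlarged-∋ {y} = ∈-toSubset⁺ (enlarged? y)

    ownPart : Node T → Subset n
    ownPart t = toSubset (ownPart? t)

    ∈-ownPart : ∀ {t v} → v ∈ ownPart t → OwnPart t v
    ∈-ownPart {t} = ∈-toSubset⁻ (ownPart? t)

    ownPart-∋ : ∀ {t v} → OwnPart t v → v ∈ ownPart t
    ownPart-∋ {t} = ∈-toSubset⁺ (ownPart? t)

  -- Every node t of T indexes a new part, empty unless t is a child of r that stays separate.
  part⁺ : Fin (p + k) → Subset n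
  part⁺ x = [ enlarged , ownPart ]′ (splitAt p x)

  part⁺-old : ∀ y → part⁺ (y ↑ˡ k) ≡ enlarged y
  part⁺-old y = cong [ enlarged , ownPart ]′ (splitAt-↑ˡ p y k)

  part⁺-new : ∀ t → part⁺ (p ↑ʳ t) ≡ ownPart t
  part⁺-new t = cong [ enlarged , ownPart ]′ (splitAt-↑ʳ p k t)

  data InPart⁺ (v : Fin n) : Fin (p + k) → Set where
    original : ∀ {y} → v ∈ part 𝒫 y → InPart⁺ v (y ↑ˡ k)
    absorbed : ∀ {y} → merged y ≡ true → target (owner v) ≡ just y → InPart⁺ v (y ↑ˡ k)
    own      : ∀ {t} → owner v ≡ t → t ≢ r → separate t ≡ true → InPart⁺ v (p ↑ʳ t)

  private
    Enlarged⇒InPart⁺ : ∀ {y v} → Enlarged y v → InPart⁺ v (y ↑ˡ k)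
    Enlarged⇒InPart⁺ (_ , inj₁ v∈y) = original v∈y
    Enlarged⇒InPart⁺ (_ , inj₂ (merged≡ , v∈U)) = absorbed merged≡ (∈-branchesOf v∈U)

    ∈-part⁺-view : ∀ {v} x → SplitView p k x → v ∈ part⁺ x → v ∉ X⁺ × InPart⁺ v x
    ∈-part⁺-view {v} .(y ↑ˡ k) (left y) v∈ =
      let enl = ∈-enlarged (subst (v ∈_) (part⁺-old y) v∈) in proj₁ enl , Enlarged⇒InPart⁺ enl
    ∈-part⁺-view {v} .(p ↑ʳ t) (right t) v∈ =
      let (v∉X , o≡t , t≢r , sep) = ∈-ownPart (subst (v ∈_) (part⁺-new t) v∈) in v∉X , own o≡t t≢r sep

  ∈-part⁺ : ∀ {v x} → v ∈ part⁺ x → v ∉ X⁺ × InPart⁺ v x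
  ∈-part⁺ {x = x} = ∈-part⁺-view x (splitView p k x)

  private
    enlarged-∋′ : ∀ {y v} → Enlarged y v → v ∈ part⁺ (y ↑ˡ k)
    enlarged-∋′ {y} {v} = subst (v ∈_) (≡.sym (part⁺-old y)) ∘ enlarged-∋

    ownPart-∋′ : ∀ {t v} → OwnPart t v → v ∈ part⁺ (p ↑ʳ t)
    ownPart-∋′ {t} {v} = subst (v ∈_) (≡.sym (part⁺-new t)) ∘ ownPart-∋

    covered-by-owner : ∀ {v} → v ∉ X⁺ → Dec (owner v ≡ r) → ∃ λ x → v ∈ part⁺ x
    covered-by-owner {v} v∉X (yes o≡r) =
      let (y , v∈y) = covers 𝒫 v (x∈p∧x∉q⇒x∈p─q (x∈p∧x∉q⇒x∈p─q (owner≡root⇒∈J-root o≡r) (∉⊥ ∘ subst (v ∈_) K-root))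
                                                 (v∉X ∘ p⊆p∪q (⋃ᶠ deleted)))
      in y ↑ˡ k , enlarged-∋′ (v∉X , inj₁ v∈y)
    covered-by-owner {v} v∉X (no o≢r) = covered-by-branch (separate (owner v) Bool.≟ true)
      where
      covered-by-branch : Dec (separate (owner v) ≡ true) → ∃ λ x → v ∈ part⁺ x
      covered-by-branch (yes sep) = p ↑ʳ owner v , ownPart-∋′ (v∉X , refl , o≢r , sep)
      covered-by-branch (no ¬sep) =
        let (y , e , merged≡) = ¬separate⇒merged (owner v) ¬sep
        in y ↑ˡ k , enlarged-∋′ (v∉X , inj₂ (merged≡ , branchesOf-∋ e))

  part⁺-covers : ∀ v → v ∈ ⊤ ─ X⁺ → ∃ λ x → v ∈ part⁺ x
  part⁺-covers v v∈ = covered-by-owner (x∈p─q⇒x∉q ⊤ X⁺ v∈) (owner v ≟ r)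

  InPart⁺-unique : ∀ {v x x'} → InPart⁺ v x → InPart⁺ v x' → x ≡ x'
  InPart⁺-unique {v} (original {y} v∈y) (original {y'} v∈y') =
    cong (_↑ˡ k) (decidable-stable (y ≟ y') λ y≢y' → disj 𝒫 y y' y≢y' v v∈y v∈y')
  InPart⁺-unique (original v∈y) (absorbed _ e) = ⊥-elim (target≢root e (∈J-root⇒owner≡root (proj₁ (part⊆ v∈y))))
  InPart⁺-unique (original v∈y) (own refl o≢r _) = ⊥-elim (o≢r (∈J-root⇒owner≡root (proj₁ (part⊆ v∈y))))
  InPart⁺-unique (absorbed _ e) (original v∈y) = ⊥-elim (target≢root e (∈J-root⇒owner≡root (proj₁ (part⊆ v∈y))))
  InPart⁺-unique (absorbed _ e) (absorbed _ e') = cong (_↑ˡ k) (Maybe.just-injective (trans (≡.sym e) e'))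
  InPart⁺-unique (absorbed merged≡ e) (own refl _ sep) = ⊥-elim (Bool.not-¬ merged≡ (separate⇒unmerged e sep))
  InPart⁺-unique (own refl o≢r _) (original v∈y) = ⊥-elim (o≢r (∈J-root⇒owner≡root (proj₁ (part⊆ v∈y))))
  InPart⁺-unique (own refl _ sep) (absorbed merged≡ e) = ⊥-elim (Bool.not-¬ merged≡ (separate⇒unmerged e sep))
  InPart⁺-unique (own refl _ _) (own refl _ _) = refl

  𝒫⁺ : Partition (⊤ ─ X⁺)
  𝒫⁺ = record
    { nparts = p + k
    ; part   = part⁺
    ; inside = λ x v∈ → x∈p∧x∉q⇒x∈p─q ∈⊤ (proj₁ (∈-part⁺ v∈))
    ; covers = part⁺-covers
    ; disj   = λ x x' x≢x' v v∈x v∈x' → x≢x' (InPart⁺-unique (proj₂ (∈-part⁺ v∈x)) (proj₂ (∈-part⁺ v∈x')))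
    }

  almostPartition : AlmostPartition {n} ⊤
  almostPartition = record { X = X⁺ ; X⊆V = λ _ → ∈⊤ ; parts = 𝒫⁺ }

  record Leaf (t : Node T) : Set where
    field
      node       : Node (tree D𝒫)
      nbrs       : Subset p
      nbrs⊆      : nbrs ⊆ bag D𝒫 node
      ∣nbrs∣≤b   : ∣ nbrs ∣ ≤ b
      meets-only : ChildOfRoot t → separate t ≡ true → (J t ─ X⁺) meetsOnly nbrs

  private
    ∣∅∣≤b : ∣ ∅ {p} ∣ ≤ b
    ∣∅∣≤b = ℕ.≤-trans (ℕ.≤-reflexive (∣⊥∣≡0 p)) z≤n

    small-leaf : ∀ t → ¬ Big t → Dec (ChildOfRoot t) → Leaf t
    small-leaf t _ (no ¬ch) = record
      { node = root (tree D𝒫) ; nbrs = ∅ ; nbrs⊆ = ⊥⊆ ; ∣nbrs∣≤b = ∣∅∣≤b ; meets-only = ⊥-elim ∘ ¬ch }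
    small-leaf t small (yes ch) = record
      { node       = proj₁ (Quotient.clique⊆bag (partsMeeting-clique ch))
      ; nbrs       = partsMeeting t
      ; nbrs⊆      = proj₂ (Quotient.clique⊆bag (partsMeeting-clique ch))
      ; ∣nbrs∣≤b   = ℕ.≮⇒≥ (λ big → small (ch , big))
      ; meets-only = λ _ _ i v v∈ v∈i → ∈-partsMeeting (p─q⊆p (J t) X⁺ v∈) v∈i
      }

    target-leaf : ∀ t o → target t ≡ o → Leaf t
    target-leaf t nothing e = small-leaf t (target-nothing e) (ChildOfRoot? t)
    target-leaf t (just y) e = record
      { node       = Quotient.top y
      ; nbrs       = B
      ; nbrs⊆      = B⊆
      ; ∣nbrs∣≤b   = ∣B∣≤b
      ; meets-only = λ _ sep i v v∈ → only i v (J⁺⊆J-S sep v∈)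
      }
      where
      S = proj₁ (groupSeparator y)
      B = proj₁ (proj₂ (proj₂ (groupSeparator y)) t e)
      B⊆ = proj₁ (proj₂ (proj₂ (proj₂ (groupSeparator y)) t e))
      ∣B∣≤b = proj₁ (proj₂ (proj₂ (proj₂ (proj₂ (groupSeparator y)) t e)))
      only = proj₂ (proj₂ (proj₂ (proj₂ (proj₂ (groupSeparator y)) t e)))

      J⁺⊆J-S : separate t ≡ true → J t ─ X⁺ ⊆ J t ─ S
      J⁺⊆J-S sep v∈ = x∈p∧x∉q⇒x∈p─q (p─q⊆p (J t) X⁺ v∈) (x∈p─q⇒x∉q (J t) X⁺ v∈ ∘ separator⊆X⁺ (separate⇒unmerged e sep))

  leaf : ∀ t → Leaf t
  leaf t = target-leaf t (target t) refl

  module Leaves = LeafExtension D𝒫 (proj₂ tw) (Leaf.node ∘ leaf) (Leaf.nbrs ∘ leaf)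
                                (λ t → Leaf.nbrs⊆ (leaf t)) (Leaf.∣nbrs∣≤b ∘ leaf)

  Covered : Fin (p + k) → Fin (p + k) → Set
  Covered x x' = ∃ λ f → x ∈ Leaves.bag⁺ f × x' ∈ Leaves.bag⁺ f

  private
    swapᶜ : ∀ {x x'} → Covered x x' → Covered x' x
    swapᶜ (f , x∈ , x'∈) = f , x'∈ , x∈

    ∈-part⇒owner≢ : ∀ {u v y} → v ∈ part 𝒫 y → owner u ≢ r → owner v ≢ owner u
    ∈-part⇒owner≢ v∈y ou≢r ov≡ou = ou≢r (trans (≡.sym ov≡ou) (∈J-root⇒owner≡root (proj₁ (part⊆ v∈y))))

    quotient-edge : ∀ {y y'} → QAdj (TorsoAdj r) 𝒫 y y' → Covered (y ↑ˡ k) (y' ↑ˡ k)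
    quotient-edge {y} {y'} adj =
      let (f , y∈f , y'∈f) = edge D𝒫 y y' adj in Leaves.old f , Leaves.∈-bag⁺-old y∈f , Leaves.∈-bag⁺-old y'∈f

    absorbed-original : ∀ {u v y y'} → y ≢ y' → E G u v → target (owner u) ≡ just y → v ∈ part 𝒫 y' →
                        Covered (y ↑ˡ k) (y' ↑ˡ k)
    absorbed-original {y = y} {y'} y≢y' uv e v∈y' =
      let ((ch , _) , y∈ , _) = target-just e
          (v∈t , _) = edge-leaving-branch uv (target≢root e) (∈-part⇒owner≢ v∈y' (target≢root e))
      in quotient-edge (partsMeeting-clique ch y y' y∈ (∈-partsMeeting v∈t v∈y') y≢y')

    own-original : ∀ {u v y t} → E G u v → v ∈ part 𝒫 y → v ∉ X⁺ → owner u ≡ t → t ≢ r → separate t ≡ true →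
                   Covered (p ↑ʳ t) (y ↑ˡ k)
    own-original {y = y} {t} uv v∈y v∉X refl t≢r sep =
      let (v∈t , _) = edge-leaving-branch uv t≢r (∈-part⇒owner≢ v∈y t≢r)
      in Leaves.leaf t , Leaves.new∈bag⁺-leaf t ,
         Leaves.∈-bag⁺-leaf (Leaf.meets-only (leaf t) (owner-child t≢r) sep y _ (x∈p∧x∉q⇒x∈p─q v∈t v∉X) v∈y)

    absorbed-absorbed : ∀ {u v y y'} → y ≢ y' → E G u v → target (owner u) ≡ just y → target (owner v) ≡ just y' → Empty
    absorbed-absorbed {u} {v} y≢y' uv e e' = by-owner (owner v ≟ owner u)
      where
      by-owner : Dec (owner v ≡ owner u) → Empty
      by-owner (yes ov≡ou) = y≢y' (Maybe.just-injective (trans (≡.sym e) (trans (cong target (≡.sym ov≡ou)) e')))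
      by-owner (no  ov≢ou) = target≢root e' (∈J-root⇒owner≡root (proj₂ (edge-leaving-branch uv (target≢root e) ov≢ou)))

    own-absorbed : ∀ {u v y t} → E G u v → owner u ≡ t → t ≢ r → separate t ≡ true →
                   target (owner v) ≡ just y → merged y ≡ true → Empty
    own-absorbed {u} {v} {y} {t} uv o≡t t≢r sep e merged≡ = by-owner (owner v ≟ t)
      where
      by-owner : Dec (owner v ≡ t) → Empty
      by-owner (yes ov≡t) = Bool.not-¬ merged≡ (separate⇒unmerged (trans (cong target (≡.sym ov≡t)) e) sep)
      by-owner (no  ov≢t) = target≢root e (∈J-root⇒owner≡root (proj₂
        (edge-leaving-branch uv (t≢r ∘ trans (≡.sym o≡t)) (λ ov≡ou → ov≢t (trans ov≡ou o≡t)))))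

    own-own : ∀ {u v t t'} → t ≢ t' → E G u v → owner u ≡ t → t ≢ r → owner v ≡ t' → t' ≢ r → Empty
    own-own t≢t' uv o≡t t≢r o'≡t' t'≢r =
      t'≢r (trans (≡.sym o'≡t') (∈J-root⇒owner≡root (proj₂ (edge-leaving-branch uv (t≢r ∘ trans (≡.sym o≡t))
                                                          (λ ov≡ou → t≢t' (trans (≡.sym o≡t) (trans (≡.sym ov≡ou) o'≡t')))))))

  covered : ∀ {x x' u v} → x ≢ x' → E G u v → u ∉ X⁺ → v ∉ X⁺ → InPart⁺ u x → InPart⁺ v x' → Covered x x'
  covered {u = u} {v} x≢x' uv _ _ (original u∈y) (original v∈y') =
    quotient-edge (x≢x' ∘ cong (_↑ˡ k) , u , v , u∈y , v∈y' , inj₁ uv)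
  covered x≢x' uv _ _ (absorbed _ e) (original v∈y') = absorbed-original (x≢x' ∘ cong (_↑ˡ k)) uv e v∈y'
  covered x≢x' uv _ _ (original u∈y) (absorbed _ e) =
    swapᶜ (absorbed-original (x≢x' ∘ cong (_↑ˡ k) ∘ ≡.sym) (sym G _ _ uv) e u∈y)
  covered x≢x' uv _ _ (absorbed _ e) (absorbed _ e') = ⊥-elim (absorbed-absorbed (x≢x' ∘ cong (_↑ˡ k)) uv e e')
  covered x≢x' uv _ v∉X (own o≡t t≢r sep) (original v∈y) = own-original uv v∈y v∉X o≡t t≢r sep
  covered x≢x' uv u∉X _ (original u∈y) (own o≡t t≢r sep) = swapᶜ (own-original (sym G _ _ uv) u∈y u∉X o≡t t≢r sep)
  covered x≢x' uv _ _ (own o≡t t≢r sep) (absorbed merged≡ e) = ⊥-elim (own-absorbed uv o≡t t≢r sep e merged≡)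
  covered x≢x' uv _ _ (absorbed merged≡ e) (own o≡t t≢r sep) = ⊥-elim (own-absorbed (sym G _ _ uv) o≡t t≢r sep e merged≡)
  covered x≢x' uv _ _ (own o≡t t≢r _) (own o'≡t' t'≢r _) = ⊥-elim (own-own (x≢x' ∘ cong (p ↑ʳ_)) uv o≡t t≢r o'≡t' t'≢r)

  treewidth-≤ : TreewidthAtMost (QAdj (E G) 𝒫⁺) b
  treewidth-≤ = Leaves.treewidth-≤ (QAdj (E G) 𝒫⁺) λ { x x' (x≢x' , u , v , u∈ , v∈ , uv) →
    covered x≢x' uv (proj₁ (∈-part⁺ u∈)) (proj₁ (∈-part⁺ v∈)) (proj₂ (∈-part⁺ u∈)) (proj₂ (∈-part⁺ v∈)) }

  private
    enlarged-width : ∀ y β → merged y ≡ β → ∣ enlarged y ∣ ≤ʳ d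
    enlarged-width y true merged≡ =
      ≤-≤ʳ-trans d (ℕ.≤-trans (p⊆q⇒∣p∣≤∣q∣ enlarged⊆) (∣p∪q∣≤∣p∣+∣q∣ (part 𝒫 y) (branchesOf y))) (merged-fits merged≡)
      where
      enlarged⊆ : enlarged y ⊆ part 𝒫 y ∪ branchesOf y
      enlarged⊆ v∈ = [ p⊆p∪q (branchesOf y) , q⊆p∪q (part 𝒫 y) (branchesOf y) ∘ proj₂ ]′ (proj₂ (∈-enlarged v∈))
    enlarged-width y false unmerged =
      ≤-≤ʳ-trans d (ℕ.≤-trans (p⊆q⇒∣p∣≤∣q∣ enlarged⊆) (ℕ.m≤m+n ∣ part 𝒫 y ∣ (∣ part 𝒫 y ∣ + 0))) (width y)
      where
      enlarged⊆ : enlarged y ⊆ part 𝒫 y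
      enlarged⊆ v∈ = [ (λ v∈y → v∈y) , (λ (merged≡ , _) → ⊥-elim (Bool.not-¬ merged≡ unmerged)) ]′ (proj₂ (∈-enlarged v∈))

    ownPart-width : ∀ t → Dec (t ≡ r) → ∣ ownPart t ∣ ≤ʳ d
    ownPart-width t (yes t≡r) = ≤-≤ʳ-trans d (ℕ.≤-trans (p⊆q⇒∣p∣≤∣q∣ ownPart⊆∅) (ℕ.≤-reflexive (∣⊥∣≡0 n))) (0≤ʳ d)
      where
      ownPart⊆∅ : ownPart t ⊆ ∅
      ownPart⊆∅ v∈ = ⊥-elim (proj₁ (proj₂ (proj₂ (∈-ownPart v∈))) t≡r)
    ownPart-width t (no t≢r) = ≤-≤ʳ-trans d (p⊆q⇒∣p∣≤∣q∣ ownPart⊆below) (below-weight {d} near-weight t≢r)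
      where
      ownPart⊆below : ownPart t ⊆ below t
      ownPart⊆below {v} v∈ =
        let (_ , o≡t , _) = ∈-ownPart v∈
        in ∈-toSubset⁺ (λ v → t ≼? top v) (subst (_≼ top v) o≡t (owner-≼ v))

    width-view : ∀ x → SplitView p k x → ∣ part⁺ x ∣ ≤ʳ d
    width-view .(y ↑ˡ k) (left y) = subst (λ P → ∣ P ∣ ≤ʳ d) (≡.sym (part⁺-old y)) (enlarged-width y (merged y) refl)
    width-view .(p ↑ʳ t) (right t) = subst (λ P → ∣ P ∣ ≤ʳ d) (≡.sym (part⁺-new t)) (ownPart-width t (t ≟ r))

  width-≤ : WidthAtMost 𝒫⁺ (λ s → s ≤ʳ d)
  width-≤ x = width-view x (splitView p k x)

  cost : Fin p → ℕ
  cost y = if merged y then 0 else m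

  private
    ∣deleted∣≤cost : ∀ y → ∣ deleted y ∣ ≤ cost y
    ∣deleted∣≤cost y = by-choice (merged y)
      where
      by-choice : ∀ β → ∣ (if β then ∅ else proj₁ (groupSeparator y)) ∣ ≤ (if β then 0 else m)
      by-choice true  = ℕ.≤-reflexive (∣⊥∣≡0 n)
      by-choice false = proj₁ (proj₂ (groupSeparator y))

    -- An unmerged group has at least d/2 vertices in its branches.
    cost-charged : ∀ y → cost y · d ≤ʳ (2 * ∣ branchesOf y ∣ * m)
    cost-charged y = by-choice (merged y) refl
      where
      by-choice : ∀ β → merged y ≡ β → (if β then 0 else m) · d ≤ʳ (2 * ∣ branchesOf y ∣ * m)
      by-choice true  _ = 0·≤ʳ d (2 * ∣ branchesOf y ∣ * m)
      by-choice false unmerged = ʳ≤⇒·≤ʳ d {2 * ∣ branchesOf y ∣} m (unmerged-exceeds unmerged)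

    ∣X⁺∣≤ : ∣ X⁺ ∣ ≤ ∣ X ap ∣ + sum cost
    ∣X⁺∣≤ = ℕ.≤-trans (∣p∪q∣≤∣p∣+∣q∣ (X ap) (⋃ᶠ deleted))
              (ℕ.+-monoʳ-≤ ∣ X ap ∣ (ℕ.≤-trans (∣⋃ᶠ∣≤sum deleted) (sum-mono-≤ ∣deleted∣≤cost)))

    branches-total : sum (λ y → ∣ branchesOf y ∣) ≤ n
    branches-total = ℕ.≤-trans (sum≤∣⋃ᶠ∣ branchesOf branches-disjoint) (∣p∣≤n (⋃ᶠ branchesOf))
      where
      branches-disjoint : ∀ i j → i ≢ j → Disjoint (branchesOf i) (branchesOf j)
      branches-disjoint i j i≢j v v∈i v∈j = i≢j (Maybe.just-injective (trans (≡.sym (∈-branchesOf v∈i)) (∈-branchesOf v∈j)))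

    budget : 2 * c * ∣ J⁻ r ∣ + sum (λ y → 2 * ∣ branchesOf y ∣ * m) ≤ 2 * (c + m) * n
    budget = begin
      2 * c * ∣ J⁻ r ∣ + sum (λ y → 2 * ∣ branchesOf y ∣ * m)  ≡⟨ cong₂ _+_ refl branches-sum ⟩
      2 * c * ∣ J⁻ r ∣ + 2 * sum (λ y → ∣ branchesOf y ∣) * m  ≤⟨ ℕ.+-mono-≤ (ℕ.*-monoʳ-≤ (2 * c) (∣p∣≤n (J⁻ r)))
                                                                   (ℕ.*-monoˡ-≤ m (ℕ.*-monoʳ-≤ 2 branches-total)) ⟩
      2 * c * n + 2 * n * m                                     ≡⟨ solve 3 (λ c m n → con 2 :* c :* n :+ con 2 :* n :* m
                                                                               := con 2 :* (c :+ m) :* n) refl c m n ⟩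
      2 * (c + m) * n                                           ∎
      where
      open ℕ.≤-Reasoning
      open +-*-Solver
      branches-sum : sum (λ y → 2 * ∣ branchesOf y ∣ * m) ≡ 2 * sum (λ y → ∣ branchesOf y ∣) * m
      branches-sum = trans (≡.sym (*-distribʳ-sum m (λ y → 2 * ∣ branchesOf y ∣)))
                           (cong (_* m) (≡.sym (*-distribˡ-sum 2 (λ y → ∣ branchesOf y ∣))))

  loss-≤ : LossBound ∣ X⁺ ∣ (2 * (c + m) * n) d q
  loss-≤ = LossBound-+ {∣ X ap ∣} {∣ X⁺ ∣} {sum cost} {2 * c * ∣ J⁻ r ∣} {sum (λ y → 2 * ∣ branchesOf y ∣ * m)} {d = d} {q}
                       loss (·≤ʳ-sum d cost-charged) ∣X⁺∣≤ budget

mainTheorem5 : (b m c q n : ℕ) (d : PosReal) (G : Graph n) (D : TreeDecomp (E G)) →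
    RTD.NearWeightAtMost G D d →
    RTD.HalfDecompAt G D b m d c q (root (tree D)) →
    Σ (AlmostPartition {n} ⊤) λ A →
      TreewidthAtMost (QAdj (E G) (parts A)) b ×
      WidthAtMost (parts A) (λ s → s ≤ʳ d) ×
      LossBound ∣ X A ∣ (2 * (c + m) * n) d q
mainTheorem5 b m c q n d G D near-weight H = almostPartition , treewidth-≤ , width-≤ , loss-≤
  where open Construction b m c q n d G D near-weight H
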